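{- Let $f,g:\mathbb{C}^n\to\mathbb{C}^n$ be polynomial maps with $f\circ g=g\circ f$, and let $P\in\mathrm{Per}(f)$. Suppose that $P$ is not a critical point of $g$, i.e. $\det\bigl(\frac{dg}{dX}(P)\bigr)\neq 0$. Then \[ \lambda_f(P)=\bigl(\lambda_f(g(P))\bigr)^{l_0},\qquad\text{where } l_0=\frac{f\text{ -period of }P}{f\text{ -period of }g(P)}. \]
   Context: $\mathrm{Per}(f)=\{P\in\mathbb{C}^n : f^m(P)=P\text{ for some } m\ge 1\}$. The $f$-period of a periodic point $P$ is the least $l\ge1$ with $f^l(P)=P$. For a polynomial map $f=(f_1,\dots,f_n)$, $\frac{df}{dX}=\bigl(\frac{\partial f_i}{\partial x_j}\bigr)$ is the Jacobian matrix. The multiplier of a periodic point $P$ of $f$-period $l$ is $\lambda_f(P):=\det\bigl(\frac{d(f^l)}{dX}(P)\bigr)=\prod_{i=1}^{l}\det\bigl(\frac{df}{dX}(f^i(P))\bigr)$. -}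

module Defs where

open import Level using (Level; _⊔_)
open import Data.Nat as ℕ using (ℕ; zero; suc)
open import Data.Fin using (Fin; zero; suc; toℕ; punchIn; _≟_)
open import Data.Product using (Σ; ∃; _×_; _,_)
open import Relation.Nullary using (¬_; yes; no)
open import Algebra.Bundles using (CommutativeRing)

module RingOps {c ℓ} (R : CommutativeRing c ℓ) where
  open CommutativeRing R using (Carrier; 0#; 1#; _+_; _*_)
  natToK : ℕ → Carrier
  natToK zero = 0#
  natToK (suc n) = 1# + natToK n
  pow : Carrier → ℕ → Carrier
  pow x zero = 1#
  pow x (suc n) = x * pow x n
  sumFin : ∀ {n} → (Fin n → Carrier) → Carrier
  sumFin {zero} f = 0#
  sumFin {suc n} f = f zero + sumFin (λ i → f (suc i))

-- An algebraically closed field of characteristic 0 (stand-in for ℂ).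
record AlgClosedChar0Field (c ℓ : Level) : Set (Level.suc (c ⊔ ℓ)) where
  field
    ring : CommutativeRing c ℓ
  open CommutativeRing ring using (Carrier; _≈_; 0#; 1#; _+_; _*_)
  open RingOps ring
  field
    nontrivial : ¬ (1# ≈ 0#)
    inverse : ∀ x → ¬ (x ≈ 0#) → ∃ λ y → x * y ≈ 1#
    char0 : ∀ n → ¬ (natToK (suc n) ≈ 0#)
    algClosed : ∀ n (a : Fin (suc n) → Carrier) →
      ∃ λ x → pow x (suc n) + sumFin (λ i → a i * pow x (toℕ i)) ≈ 0#
  open CommutativeRing ring public using (Carrier; _≈_; 0#; 1#; _+_; _*_; -_)
  open RingOps ring public

module Poly {c ℓ} (K : AlgClosedChar0Field c ℓ) where
  open AlgClosedChar0Field K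

  Pt : ℕ → Set c
  Pt n = Fin n → Carrier

  _≈ᵥ_ : ∀ {n} → Pt n → Pt n → Set ℓ
  P ≈ᵥ Q = ∀ i → P i ≈ Q i

  data Pol (n : ℕ) : Set c where
    con : Carrier → Pol n
    var : Fin n → Pol n
    _⊕_ : Pol n → Pol n → Pol n
    _⊗_ : Pol n → Pol n → Pol n

  eval : ∀ {n} → Pol n → Pt n → Carrier
  eval (con a) x = a
  eval (var i) x = x i
  eval (p ⊕ q) x = eval p x + eval q x
  eval (p ⊗ q) x = eval p x * eval q x

  ∂ : ∀ {n} → Fin n → Pol n → Pol n
  ∂ j (con a) = con 0#
  ∂ j (var i) with i ≟ j
  ... | yes _ = con 1#
  ... | no _ = con 0#
  ∂ j (p ⊕ q) = ∂ j p ⊕ ∂ j q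
  ∂ j (p ⊗ q) = (∂ j p ⊗ q) ⊕ (p ⊗ ∂ j q)

  PolyMap : ℕ → Set c
  PolyMap n = Fin n → Pol n

  apply : ∀ {n} → PolyMap n → Pt n → Pt n
  apply F x i = eval (F i) x

  jacobian : ∀ {n} → PolyMap n → Pt n → Fin n → Fin n → Carrier
  jacobian F x i j = eval (∂ j (F i)) x

  det : ∀ {n} → (Fin n → Fin n → Carrier) → Carrier
  det {zero} M = 1#
  det {suc n} M =
    sumFin (λ j → (pow (- 1#) (toℕ j) * M zero j) * det (λ a b → M (suc a) (punchIn j b)))

  iter : ∀ {a} {A : Set a} → ℕ → (A → A) → A → A
  iter zero h x = x
  iter (suc m) h x = h (iter m h x)

  IsPeriod : ∀ {n} → PolyMap n → Pt n → ℕ → Set ℓ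
  IsPeriod F P l =
    (1 ℕ.≤ l) × (iter l (apply F) P ≈ᵥ P)
      × (∀ m → 1 ℕ.≤ m → m ℕ.< l → ¬ (iter m (apply F) P ≈ᵥ P))

  prodDet : ∀ {n} → PolyMap n → Pt n → ℕ → Carrier
  prodDet F P zero = 1#
  prodDet F P (suc l) = det (jacobian F (iter (suc l) (apply F) P)) * prodDet F P l

  -- multiplier λ_F(P) of P, where l is its F-period
  multiplier : ∀ {n} → PolyMap n → Pt n → ℕ → Carrier
  multiplier F P l = prodDet F P l

module Submission where

-- Let f ∘ g = g ∘ f, let P have f-period l, g(P) have f-period l′, and det g′(P) ≠ 0.  Put
-- aᵢ = det f′(fⁱP), bᵢ = det f′(fⁱgP) and cᵢ = det g′(fⁱP).  Differentiating f ∘ g = g ∘ f at fⁱP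
-- (chain rule, then det(AB) = det A · det B) gives bᵢ·cᵢ = cᵢ₊₁·aᵢ, so over one period the products
-- telescope: (∏ b)·c₀ = c_l·(∏ a) = c₀·(∏ a).  Cancelling c₀ ≠ 0, λ_f(P) is the product of det f′
-- over l steps of the orbit of g(P); since l′ divides l, this is λ_f(g(P))^{l/l′}.

open import Defs
import Level
open import Function using (_∘_; _∘₂_; const)
open import Data.Nat as ℕ using (ℕ; zero; suc)
open import Data.Fin as F using (Fin; zero; suc; toℕ; punchIn; punchOut)
import Data.Fin.Properties as FP
open import Data.Vec.Functional using (updateAt)
open import Data.Vec.Functional.Properties
  using (updateAt-updates; updateAt-minimal; updateAt-commutes; updateAt-id-local; map-updateAt-local)
open import Data.Product using (∃; _×_; _,_; proj₁; proj₂)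
open import Data.Sum using (_⊎_; inj₁; inj₂)
open import Data.Empty using (⊥-elim)
open import Data.List using (List; []; _∷_; length)
open import Data.List.Relation.Unary.All using (All; []; _∷_)
open import Data.Maybe using (nothing)
open import Relation.Nullary using (¬_; yes; no; Dec)
open import Relation.Binary.PropositionalEquality as ≡ using (_≡_; _≢_)
open import Algebra.Bundles using (CommutativeRing)
import Algebra.Properties.Ring as RingProperties
import Algebra.Properties.Semiring.Sum as SemiringSum
import Data.Nat.Properties as ℕP
import Data.Nat.DivMod as ℕD
import Relation.Binary.Reasoning.Setoid as SetoidReasoning

module Proof {c ℓ} (K : AlgClosedChar0Field c ℓ) where
  open AlgClosedChar0Field K
  open Poly K
  open CommutativeRing ring using (_-_; refl; sym; trans; reflexive; setoid; +-cong; *-cong; +-congˡ;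
    +-congʳ; *-congˡ; *-congʳ; +-identityˡ; +-identityʳ; *-identityˡ; *-identityʳ; zeroˡ; zeroʳ; -‿cong;
    -‿inverseʳ; +-comm; *-comm; +-assoc; *-assoc; distribˡ; distribʳ; commutativeSemiring; semiring)
  open RingProperties (CommutativeRing.ring ring) using (-1*x≈-x; -‿involutive; -0#≈0#; x∙y⁻¹≈ε⇒x≈y;
    +-inverseʳ-unique; -‿+-comm; -‿distribˡ-*; -‿distribʳ-*; x+x≈x⇒x≈0)
  open SemiringSum semiring using (sum; sum-cong-≋; sum-replicate-zero; sum-remove; ∑-distrib-+; ∑-comm;
    *-distribˡ-sum; *-distribʳ-sum)
  open import Algebra.Solver.Ring.NaturalCoefficients commutativeSemiring (λ _ _ → nothing)
  open SetoidReasoning setoid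

  cancel : ∀ {x y} → ¬ (x ≈ 0#) → x * y ≈ 0# → y ≈ 0#
  cancel {x} {y} x≉0 xy≈0 with inverse x x≉0
  ... | x⁻¹ , xx⁻¹≈1 = begin
    y              ≈⟨ sym (*-identityˡ y) ⟩
    1# * y         ≈⟨ *-congʳ (sym xx⁻¹≈1) ⟩
    (x * x⁻¹) * y  ≈⟨ solve 3 (λ x z y → (x :* z) :* y := z :* (x :* y)) refl x x⁻¹ y ⟩
    x⁻¹ * (x * y)  ≈⟨ *-congˡ xy≈0 ⟩
    x⁻¹ * 0#       ≈⟨ zeroʳ x⁻¹ ⟩
    0#             ∎

  cancelˡ : ∀ {z x y} → ¬ (z ≈ 0#) → z * x ≈ z * y → x ≈ y
  cancelˡ {z} {x} {y} z≉0 zx≈zy = x∙y⁻¹≈ε⇒x≈y x y (cancel z≉0 (begin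
    z * (x - y)        ≈⟨ distribˡ z x (- y) ⟩
    z * x + z * - y    ≈⟨ +-cong zx≈zy (sym (-‿distribʳ-* z y)) ⟩
    z * y + - (z * y)  ≈⟨ -‿inverseʳ _ ⟩
    0#                 ∎))

  -- Characteristic ≠ 2: x ≈ -x forces x ≈ 0 (this makes det alternating).
  x≈-x⇒x≈0 : ∀ {x} → x ≈ - x → x ≈ 0#
  x≈-x⇒x≈0 {x} x≈-x = cancel two≉0 (begin
    (1# + 1#) * x    ≈⟨ distribʳ x 1# 1# ⟩
    1# * x + 1# * x  ≈⟨ +-cong (*-identityˡ x) (trans (*-identityˡ x) x≈-x) ⟩
    x + - x          ≈⟨ -‿inverseʳ x ⟩
    0#               ∎)
    where
    two≉0 : ¬ ((1# + 1#) ≈ 0#)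
    two≉0 2≈0 = char0 1 (trans (+-congˡ (+-identityʳ 1#)) 2≈0)

  -x≈0⇒x≈0 : ∀ {x} → - x ≈ 0# → x ≈ 0#
  -x≈0⇒x≈0 {x} -x≈0 = trans (sym (-‿involutive x)) (trans (-‿cong -x≈0) -0#≈0#)

  pow-+ : ∀ x m k → pow x (m ℕ.+ k) ≈ pow x m * pow x k
  pow-+ x zero    k = sym (*-identityˡ _)
  pow-+ x (suc m) k = trans (*-congˡ (pow-+ x m k)) (sym (*-assoc _ _ _))

  pow-cong : ∀ {x y} → x ≈ y → ∀ k → pow x k ≈ pow y k
  pow-cong x≈y zero    = refl
  pow-cong x≈y (suc k) = *-cong x≈y (pow-cong x≈y k)

  sgn : ∀ {n} → Fin n → Carrier
  sgn j = pow (- 1#) (toℕ j)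

  sumFin≡sum : ∀ {n} (f : Fin n → Carrier) → sumFin f ≡ sum f
  sumFin≡sum {zero}  f = ≡.refl
  sumFin≡sum {suc n} f = ≡.cong (f zero +_) (sumFin≡sum (f ∘ suc))

  Σ-sum : ∀ {n} (f : Fin n → Carrier) → sumFin f ≈ sum f
  Σ-sum f = reflexive (sumFin≡sum f)

  Σ-cong : ∀ {n} {f g : Fin n → Carrier} → (∀ i → f i ≈ g i) → sumFin f ≈ sumFin g
  Σ-cong {f = f} {g} f≈g = trans (Σ-sum f) (trans (sum-cong-≋ f≈g) (sym (Σ-sum g)))

  Σ-zero : ∀ {n} (f : Fin n → Carrier) → (∀ i → f i ≈ 0#) → sumFin f ≈ 0#
  Σ-zero {n} f f≈0 = trans (Σ-sum f) (trans (sum-cong-≋ f≈0) (sum-replicate-zero n))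

  Σ-+ : ∀ {n} (f g : Fin n → Carrier) → sumFin (λ i → f i + g i) ≈ sumFin f + sumFin g
  Σ-+ f g = trans (Σ-sum (λ i → f i + g i)) (trans (∑-distrib-+ f g) (sym (+-cong (Σ-sum f) (Σ-sum g))))

  Σ-*ˡ : ∀ {n} a (f : Fin n → Carrier) → a * sumFin f ≈ sumFin (λ i → a * f i)
  Σ-*ˡ a f = trans (*-congˡ (Σ-sum f)) (trans (*-distribˡ-sum a f) (sym (Σ-sum (λ i → a * f i))))

  Σ-*ʳ : ∀ {n} a (f : Fin n → Carrier) → sumFin f * a ≈ sumFin (λ i → f i * a)
  Σ-*ʳ a f = trans (*-congʳ (Σ-sum f)) (trans (*-distribʳ-sum a f) (sym (Σ-sum (λ i → f i * a))))

  Σ-neg : ∀ {n} (f : Fin n → Carrier) → sumFin (λ i → - f i) ≈ - sumFin f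
  Σ-neg f = begin
    sumFin (λ i → - f i)        ≈⟨ Σ-cong (λ i → sym (-1*x≈-x (f i))) ⟩
    sumFin (λ i → - 1# * f i)   ≈⟨ sym (Σ-*ˡ (- 1#) f) ⟩
    - 1# * sumFin f             ≈⟨ -1*x≈-x _ ⟩
    - sumFin f                  ∎

  Σ-comm : ∀ {m n} (f : Fin m → Fin n → Carrier) →
    sumFin (λ i → sumFin (λ j → f i j)) ≈ sumFin (λ j → sumFin (λ i → f i j))
  Σ-comm f = begin
    sumFin (λ i → sumFin (f i))          ≈⟨ Σ-sum² f ⟩
    sum (λ i → sum (f i))                ≈⟨ ∑-comm f ⟩
    sum (λ j → sum (λ i → f i j))        ≈⟨ sym (Σ-sum² (λ j i → f i j)) ⟩
    sumFin (λ j → sumFin (λ i → f i j))  ∎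
    where
    Σ-sum² : ∀ {m n} (h : Fin m → Fin n → Carrier) → sumFin (λ i → sumFin (h i)) ≈ sum (λ i → sum (h i))
    Σ-sum² h = trans (Σ-sum (λ i → sumFin (h i))) (sum-cong-≋ (λ i → Σ-sum (h i)))

  Σ-remove : ∀ {n} (f : Fin (suc n) → Carrier) j → sumFin f ≈ f j + sumFin (f ∘ punchIn j)
  Σ-remove f j = trans (Σ-sum f) (trans (sum-remove {i = j} f) (+-congˡ (sym (Σ-sum (f ∘ punchIn j)))))

  Σ-single : ∀ {n} (f : Fin n → Carrier) i → (∀ k → k ≢ i → f k ≈ 0#) → sumFin f ≈ f i
  Σ-single {suc n} f i others≈0 = begin
    sumFin f                        ≈⟨ Σ-remove f i ⟩
    f i + sumFin (f ∘ punchIn i)    ≈⟨ +-congˡ (Σ-zero _ (λ k → others≈0 (punchIn i k) (FP.punchInᵢ≢i i k))) ⟩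
    f i + 0#                        ≈⟨ +-identityʳ _ ⟩
    f i                             ∎

  Σ-linear : ∀ {n} (f g h : Fin n → Carrier) a → (∀ j → f j ≈ a * g j + h j) →
    sumFin f ≈ a * sumFin g + sumFin h
  Σ-linear f g h a f≈ag+h = begin
    sumFin f                             ≈⟨ Σ-cong f≈ag+h ⟩
    sumFin (λ j → a * g j + h j)         ≈⟨ Σ-+ (λ j → a * g j) h ⟩
    sumFin (λ j → a * g j) + sumFin h    ≈⟨ +-congʳ (sym (Σ-*ˡ a g)) ⟩
    a * sumFin g + sumFin h              ∎

  Mat : ℕ → Set c
  Mat n = Fin n → Fin n → Carrier

  infix 4 _≈ₘ_
  _≈ₘ_ : ∀ {n} → Mat n → Mat n → Set ℓ
  A ≈ₘ B = ∀ i j → A i j ≈ B i j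

  ≡⇒≈ₘ : ∀ {n} {A B : Mat n} → (∀ k → A k ≡ B k) → A ≈ₘ B
  ≡⇒≈ₘ A≡B k c = reflexive (≡.cong (λ row → row c) (A≡B k))

  infixl 6 _[_]≔_
  _[_]≔_ : ∀ {a} {A : Set a} {n} → (Fin n → A) → Fin n → A → Fin n → A
  M [ i ]≔ r = updateAt M i (const r)

  ≔-same : ∀ {a} {A : Set a} {n} (M : Fin n → A) i r → (M [ i ]≔ r) i ≡ r
  ≔-same M i r = updateAt-updates i M

  ≔-other : ∀ {a} {A : Set a} {n} (M : Fin n → A) {i} r k → k ≢ i → (M [ i ]≔ r) k ≡ M k
  ≔-other M {i} r k k≢i = updateAt-minimal k i M k≢i

  swapAt : ∀ {a} {A : Set a} {n} → (Fin n → A) → Fin n → Fin n → Fin n → A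
  swapAt xs i j = (xs [ i ]≔ xs j) [ j ]≔ xs i

  swapAt-map : ∀ {a b} {A : Set a} {B : Set b} {n} (g : A → B) (xs : Fin n → A) i j k →
    g (swapAt xs i j k) ≡ swapAt (g ∘ xs) i j k
  swapAt-map g xs i j k with k F.≟ j | k F.≟ i
  ... | yes ≡.refl | _ = ≡.trans (≡.cong g (≔-same _ k (xs i))) (≡.sym (≔-same _ k (g (xs i))))
  ... | no k≢j | yes ≡.refl = ≡.trans (≡.cong g (≡.trans (≔-other _ (xs k) k k≢j) (≔-same xs k (xs j))))
                                (≡.sym (≡.trans (≔-other _ (g (xs k)) k k≢j) (≔-same (g ∘ xs) k (g (xs j)))))
  ... | no k≢j | no k≢i = ≡.trans (≡.cong g (≡.trans (≔-other _ (xs i) k k≢j) (≔-other xs (xs j) k k≢i)))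
                            (≡.sym (≡.trans (≔-other _ (g (xs i)) k k≢j) (≔-other (g ∘ xs) (g (xs j)) k k≢i)))

  ≔-intro : ∀ {n} {A M : Mat n} i r → (∀ c → A i c ≈ r c) → (∀ k → k ≢ i → ∀ c → A k c ≈ M k c) →
    A ≈ₘ M [ i ]≔ r
  ≔-intro {M = M} i r rowᵢ others k c with k F.≟ i
  ... | yes ≡.refl rewrite ≔-same M k r = rowᵢ c
  ... | no k≢i rewrite ≔-other M r k k≢i = others k k≢i c

  ≔-cong : ∀ {n} (M : Mat n) i {r s : Fin n → Carrier} → (∀ c → r c ≈ s c) → M [ i ]≔ r ≈ₘ M [ i ]≔ s
  ≔-cong M i {r} r≈s = ≔-intro i _ (λ c → trans (reflexive (≡.cong (λ row → row c) (≔-same M i r))) (r≈s c))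
    (λ k k≢i c → reflexive (≡.cong (λ row → row c) (≔-other M r k k≢i)))

  -- Determinants: the Laplace expansion of Defs is congruent and linear in each row.

  minor : ∀ {n} → Fin (suc n) → Mat (suc n) → Mat n
  minor j M a b = M (suc a) (punchIn j b)

  det-cong : ∀ {n} {A B : Mat n} → A ≈ₘ B → det A ≈ det B
  det-cong {zero}  A≈B = refl
  det-cong {suc n} A≈B = Σ-cong (λ j →
    *-cong (*-congˡ {sgn j} (A≈B zero j)) (det-cong (λ a b → A≈B (suc a) (punchIn j b))))

  minor-≔ : ∀ {n} (N : Mat (suc (suc n))) p r j → minor j (N [ suc p ]≔ r) ≈ₘ minor j N [ p ]≔ (r ∘ punchIn j)
  minor-≔ N p r j a b =
    reflexive (≡.cong (λ row → row b) (map-updateAt-local {f = λ row → row ∘ punchIn j} (N ∘ suc) p ≡.refl a))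

  LinearIn : ∀ {n} → (Mat n → Carrier) → Fin n → Set (c Level.⊔ ℓ)
  LinearIn ψ p = ∀ N a (u v : Fin _ → Carrier) →
    ψ (N [ p ]≔ (λ k → a * u k + v k)) ≈ a * ψ (N [ p ]≔ u) + ψ (N [ p ]≔ v)

  det-linear : ∀ {n} (p : Fin n) → LinearIn det p
  det-linear {suc n} zero N a u v = Σ-linear _ _ _ a (λ j →
    solve 5 (λ s u v a D → (s :* (a :* u :+ v)) :* D := a :* ((s :* u) :* D) :+ (s :* v) :* D) refl
      (sgn j) (u j) (v j) a (det (minor j N)))
  det-linear {suc (suc n)} (suc p) N a u v = Σ-linear _ _ _ a (λ j → begin
    e j * det (minor j (N [ suc p ]≔ w))                   ≈⟨ *-congˡ (det-cong (minor-≔ N p w j)) ⟩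
    e j * det (minor j N [ p ]≔ (w ∘ punchIn j))           ≈⟨ *-congˡ (det-linear p (minor j N) a _ _) ⟩
    e j * (a * det (minor j N [ p ]≔ (u ∘ punchIn j)) + det (minor j N [ p ]≔ (v ∘ punchIn j)))
      ≈⟨ *-congˡ (+-cong (*-congˡ (det-cong (sym ∘₂ minor-≔ N p u j))) (det-cong (sym ∘₂ minor-≔ N p v j))) ⟩
    e j * (a * det (minor j (N [ suc p ]≔ u)) + det (minor j (N [ suc p ]≔ v)))
      ≈⟨ solve 4 (λ e a X Y → e :* (a :* X :+ Y) := a :* (e :* X) :+ e :* Y) refl (e j) a _ _ ⟩
    a * (e j * det (minor j (N [ suc p ]≔ u))) + e j * det (minor j (N [ suc p ]≔ v)) ∎)
    where
    w = λ k → a * u k + v k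
    e = λ j → sgn j * N zero j

  -- Alternation.  Exchanging two rows of a form that is linear in both and vanishes when they
  -- agree changes its sign; this reduces alternation of det to the first two rows.

  Congruent : ∀ {n} → (Mat n → Carrier) → Set (c Level.⊔ ℓ)
  Congruent ψ = ∀ {A B} → A ≈ₘ B → ψ A ≈ ψ B

  AlternatingIn : ∀ {n} → (Mat n → Carrier) → Fin n → Fin n → Set (c Level.⊔ ℓ)
  AlternatingIn ψ i j = ∀ N → (∀ c → N i c ≈ N j c) → ψ N ≈ 0#

  additiveIn : ∀ {n} (ψ : Mat n → Carrier) → Congruent ψ → ∀ {p} → LinearIn ψ p →
    ∀ N u v → ψ (N [ p ]≔ (λ k → u k + v k)) ≈ ψ (N [ p ]≔ u) + ψ (N [ p ]≔ v)
  additiveIn ψ cong {p} lin N u v = begin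
    ψ (N [ p ]≔ (λ k → u k + v k))          ≈⟨ cong (≔-cong N p (λ k → +-congʳ (sym (*-identityˡ (u k))))) ⟩
    ψ (N [ p ]≔ (λ k → 1# * u k + v k))     ≈⟨ lin N 1# u v ⟩
    1# * ψ (N [ p ]≔ u) + ψ (N [ p ]≔ v)    ≈⟨ +-congʳ (*-identityˡ _) ⟩
    ψ (N [ p ]≔ u) + ψ (N [ p ]≔ v)         ∎

  swap-antisymmetric : ∀ {n} (ψ : Mat n → Carrier) → Congruent ψ → ∀ {i j} → i ≢ j →
    LinearIn ψ i → LinearIn ψ j → AlternatingIn ψ i j → ∀ M → ψ (swapAt M i j) ≈ - ψ M
  swap-antisymmetric ψ cong {i} {j} i≢j linᵢ linⱼ alt M = +-inverseʳ-unique (ψ M) _ (begin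
    ψ M + ψ (W v u)
      ≈⟨ +-congʳ (cong (≡⇒≈ₘ (≡.sym ∘ W-uv))) ⟩
    ψ (W u v) + ψ (W v u)
      ≈⟨ solve 2 (λ a b → a :+ b := (con 0 :+ b) :+ (a :+ con 0)) refl _ _ ⟩
    (0# + ψ (W v u)) + (ψ (W u v) + 0#)
      ≈⟨ sym (+-cong (+-congʳ (diag u)) (+-congˡ (diag v))) ⟩
    (ψ (W u u) + ψ (W v u)) + (ψ (W u v) + ψ (W v v))
      ≈⟨ sym (+-cong (addᵢ u) (addᵢ v)) ⟩
    ψ (W s u) + ψ (W s v)
      ≈⟨ sym (additiveIn ψ cong linⱼ (M [ i ]≔ s) u v) ⟩
    ψ (W s s)
      ≈⟨ diag s ⟩
    0# ∎)
    where
    u = M i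
    v = M j
    s = λ k → u k + v k
    W : (Fin _ → Carrier) → (Fin _ → Carrier) → Mat _
    W x y = (M [ i ]≔ x) [ j ]≔ y
    diag : ∀ x → ψ (W x x) ≈ 0#
    diag x = alt (W x x) (λ c → reflexive (≡.cong (λ row → row c)
      (≡.trans (≡.trans (≔-other _ x i i≢j) (≔-same M i x)) (≡.sym (≔-same _ j x)))))
    W-uv : ∀ k → W u v k ≡ M k
    W-uv k = ≡.trans (updateAt-id-local j (M [ i ]≔ u) (≡.sym (≔-other M u j (i≢j ∘ ≡.sym))) k)
                     (updateAt-id-local i M ≡.refl k)
    W-comm : ∀ x y → W x y ≈ₘ (M [ j ]≔ y) [ i ]≔ x
    W-comm x y = ≡⇒≈ₘ (≡.sym ∘ updateAt-commutes i j i≢j M)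
    addᵢ : ∀ y → ψ (W s y) ≈ ψ (W u y) + ψ (W v y)
    addᵢ y = begin
      ψ (W s y)                                              ≈⟨ cong (W-comm s y) ⟩
      ψ ((M [ j ]≔ y) [ i ]≔ s)                              ≈⟨ additiveIn ψ cong linᵢ (M [ j ]≔ y) u v ⟩
      ψ ((M [ j ]≔ y) [ i ]≔ u) + ψ ((M [ j ]≔ y) [ i ]≔ v)  ≈⟨ sym (+-cong (cong (W-comm u y)) (cong (W-comm v y))) ⟩
      ψ (W u y) + ψ (W v y)                                  ∎

  -- Combinatorics of punchIn for the double Laplace expansion: inserting columns a then k is
  -- the same as inserting b = punchIn a k then a's position among the remaining columns,
  -- and the two index pairs have sums of opposite parity.
  punchIn-exchange : ∀ {n} (a : Fin (suc (suc n))) k (b≢a : punchIn a k ≢ a) c →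
    punchIn a (punchIn k c) ≡ punchIn (punchIn a k) (punchIn (punchOut b≢a) c)
  punchIn-exchange zero    k       b≢a c       = ≡.refl
  punchIn-exchange (suc a) zero    b≢a c       = ≡.refl
  punchIn-exchange {suc n} (suc a) (suc k) b≢a zero    = ≡.refl
  punchIn-exchange {suc n} (suc a) (suc k) b≢a (suc c) = ≡.cong suc (punchIn-exchange a k (b≢a ∘ ≡.cong suc) c)

  punch-parity : ∀ {n} (a : Fin (suc (suc n))) k (b≢a : punchIn a k ≢ a) →
    (toℕ a ℕ.+ toℕ k ≡ suc (toℕ (punchIn a k) ℕ.+ toℕ (punchOut b≢a))) ⊎
    (toℕ (punchIn a k) ℕ.+ toℕ (punchOut b≢a) ≡ suc (toℕ a ℕ.+ toℕ k))
  punch-parity zero    k    b≢a = inj₂ (≡.cong suc (ℕP.+-identityʳ (toℕ k)))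
  punch-parity (suc a) zero b≢a = inj₁ (≡.cong suc (ℕP.+-identityʳ (toℕ a)))
  punch-parity {suc n} (suc a) (suc k) b≢a with punch-parity a k (b≢a ∘ ≡.cong suc)
  ... | inj₁ e = inj₁ (≡.cong suc (≡.trans (ℕP.+-suc (toℕ a) (toℕ k))
                        (≡.cong suc (≡.trans e (≡.sym (ℕP.+-suc (toℕ (punchIn a k)) _))))))
  ... | inj₂ e = inj₂ (≡.cong suc (≡.trans (ℕP.+-suc (toℕ (punchIn a k)) _)
                        (≡.cong suc (≡.trans e (≡.sym (ℕP.+-suc (toℕ a) (toℕ k)))))))

  sgn-exchange : ∀ {n} (a : Fin (suc (suc n))) k (b≢a : punchIn a k ≢ a) →
    sgn a * sgn k ≈ - (sgn (punchIn a k) * sgn (punchOut b≢a))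
  sgn-exchange a k b≢a with punch-parity a k b≢a
  ... | inj₁ e = begin
    sgn a * sgn k              ≈⟨ sym (pow-+ (- 1#) (toℕ a) (toℕ k)) ⟩
    pow (- 1#) (toℕ a ℕ.+ toℕ k) ≡⟨ ≡.cong (pow (- 1#)) e ⟩
    pow (- 1#) (suc t)         ≈⟨ -1*x≈-x _ ⟩
    - pow (- 1#) t             ≈⟨ -‿cong (pow-+ (- 1#) (toℕ b) (toℕ q)) ⟩
    - (sgn b * sgn q)          ∎
    where b = punchIn a k; q = punchOut b≢a; t = toℕ b ℕ.+ toℕ q
  ... | inj₂ e = begin
    sgn a * sgn k              ≈⟨ sym (pow-+ (- 1#) (toℕ a) (toℕ k)) ⟩
    pow (- 1#) t               ≈⟨ sym (-‿involutive _) ⟩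
    - (- pow (- 1#) t)         ≈⟨ -‿cong (sym (-1*x≈-x _)) ⟩
    - pow (- 1#) (suc t)       ≡⟨ ≡.cong (λ m → - pow (- 1#) m) (≡.sym e) ⟩
    - pow (- 1#) (toℕ b ℕ.+ toℕ q) ≈⟨ -‿cong (pow-+ (- 1#) (toℕ b) (toℕ q)) ⟩
    - (sgn b * sgn q)          ∎
    where b = punchIn a k; q = punchOut b≢a; t = toℕ a ℕ.+ toℕ k

  -- A determinant whose first two rows agree vanishes.  Expanding along both rows gives
  -- det N = Σₐ Σ_b N₀ₐ N₀_b E a b with E antisymmetric, so det N ≈ - det N.
  module EqualFirstRows {m : ℕ} (N : Mat (suc (suc m))) where
    -- D j k: the minor left after deleting rows 0, 1 and columns j, punchIn j k.
    D : Fin (suc (suc m)) → Fin (suc m) → Carrier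
    D j k = det (minor k (minor j N))

    E′ : ∀ a b → Dec (a ≡ b) → Carrier
    E′ a b (yes _)  = 0#
    E′ a b (no a≢b) = (sgn a * sgn (punchOut a≢b)) * D a (punchOut a≢b)

    -- E a b is the signed cofactor of columns a (row 0) and b (row 1); E a a = 0.
    E : Fin (suc (suc m)) → Fin (suc (suc m)) → Carrier
    E a b = E′ a b (a F.≟ b)

    E-diag : ∀ a → E a a ≈ 0#
    E-diag a with a F.≟ a
    ... | yes _   = refl
    ... | no a≢a = ⊥-elim (a≢a ≡.refl)

    E-off : ∀ a b (a≢b : a ≢ b) → E a b ≈ (sgn a * sgn (punchOut a≢b)) * D a (punchOut a≢b)
    E-off a b a≢b with a F.≟ b
    ... | yes a≡b  = ⊥-elim (a≢b a≡b)
    ... | no a≢b′ rewrite FP.punchOut-cong a {i≢j = a≢b′} {i≢k = a≢b} ≡.refl = refl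

    E-punchIn : ∀ j k → E j (punchIn j k) ≈ (sgn j * sgn k) * D j k
    E-punchIn j k = ≡.subst (λ t → E j (punchIn j k) ≈ (sgn j * sgn t) * D j t)
      (FP.punchOut-punchIn j) (E-off j (punchIn j k) (FP.punchInᵢ≢i j k ∘ ≡.sym))

    E-antisym-punchIn : ∀ a k → E a (punchIn a k) ≈ - E (punchIn a k) a
    E-antisym-punchIn a k = begin
      E a (punchIn a k)                     ≈⟨ E-punchIn a k ⟩
      (sgn a * sgn k) * D a k               ≈⟨ *-cong (sgn-exchange a k b≢a) (det-cong columns) ⟩
      - (sgn b * sgn q) * D b q             ≈⟨ sym (-‿distribˡ-* _ _) ⟩
      - ((sgn b * sgn q) * D b q)           ≈⟨ -‿cong (sym (E-off b a b≢a)) ⟩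
      - E b a                               ∎
      where
      b = punchIn a k
      b≢a = FP.punchInᵢ≢i a k
      q = punchOut b≢a
      columns : minor k (minor a N) ≈ₘ minor q (minor b N)
      columns x y = reflexive (≡.cong (N (suc (suc x))) (punchIn-exchange a k b≢a y))

    E-antisym : ∀ a b → E a b ≈ - E b a
    E-antisym a b = by-cases (a F.≟ b)
      where
      by-cases : Dec (a ≡ b) → E a b ≈ - E b a
      by-cases (yes ≡.refl) = trans (E-diag a) (sym (trans (-‿cong (E-diag a)) -0#≈0#))
      by-cases (no a≢b)     = ≡.subst (λ t → E a t ≈ - E t a) (FP.punchIn-punchOut a≢b)
                                (E-antisym-punchIn a (punchOut a≢b))

    X : Carrier
    X = sumFin (λ a → sumFin (λ b → (N zero a * N zero b) * E a b))

    det≈X : (∀ c → N zero c ≈ N (suc zero) c) → det N ≈ X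
    det≈X rows₀₁ = Σ-cong (λ j → begin
      (sgn j * N zero j) * sumFin (λ k → (sgn k * N (suc zero) (punchIn j k)) * D j k)
        ≈⟨ Σ-*ˡ (sgn j * N zero j) (λ k → (sgn k * N (suc zero) (punchIn j k)) * D j k) ⟩
      sumFin (λ k → (sgn j * N zero j) * ((sgn k * N (suc zero) (punchIn j k)) * D j k))
        ≈⟨ Σ-cong (λ k → term j k) ⟩
      sumFin (G j ∘ punchIn j)                ≈⟨ sym (+-identityˡ _) ⟩
      0# + sumFin (G j ∘ punchIn j)           ≈⟨ +-congʳ (sym (trans (*-congˡ (E-diag j)) (zeroʳ _))) ⟩
      G j j + sumFin (G j ∘ punchIn j)        ≈⟨ sym (Σ-remove (G j) j) ⟩
      sumFin (G j)                            ∎)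
      where
      G : Fin (suc (suc m)) → Fin (suc (suc m)) → Carrier
      G a b = (N zero a * N zero b) * E a b
      term : ∀ j k → (sgn j * N zero j) * ((sgn k * N (suc zero) (punchIn j k)) * D j k) ≈ G j (punchIn j k)
      term j k = begin
        (sgn j * N zero j) * ((sgn k * N (suc zero) (punchIn j k)) * D j k)
          ≈⟨ *-congˡ (*-congʳ (*-congˡ (sym (rows₀₁ (punchIn j k))))) ⟩
        (sgn j * N zero j) * ((sgn k * N zero (punchIn j k)) * D j k)
          ≈⟨ solve 5 (λ s u t w d → (s :* u) :* ((t :* w) :* d) := (u :* w) :* ((s :* t) :* d)) refl
               (sgn j) (N zero j) (sgn k) (N zero (punchIn j k)) (D j k) ⟩
        (N zero j * N zero (punchIn j k)) * ((sgn j * sgn k) * D j k)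
          ≈⟨ *-congˡ (sym (E-punchIn j k)) ⟩
        G j (punchIn j k) ∎

    X≈-X : X ≈ - X
    X≈-X = begin
      X                                        ≈⟨ Σ-cong (λ a → Σ-cong (λ b → flip a b)) ⟩
      sumFin (λ a → sumFin (λ b → - T a b))    ≈⟨ Σ-cong (λ a → Σ-neg (T a)) ⟩
      sumFin (λ a → - sumFin (T a))            ≈⟨ Σ-neg (λ a → sumFin (T a)) ⟩
      - sumFin (λ a → sumFin (T a))            ≈⟨ -‿cong (Σ-comm T) ⟩
      - X                                      ∎
      where
      T : Fin (suc (suc m)) → Fin (suc (suc m)) → Carrier
      T a b = (N zero b * N zero a) * E b a
      flip : ∀ a b → (N zero a * N zero b) * E a b ≈ - T a b
      flip a b = trans (*-cong (*-comm _ _) (E-antisym a b)) (sym (-‿distribʳ-* _ _))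

  det-alternating₀₁ : ∀ {m} → AlternatingIn {suc (suc m)} det zero (suc zero)
  det-alternating₀₁ N rows₀₁ = trans (det≈X rows₀₁) (x≈-x⇒x≈0 X≈-X)
    where open EqualFirstRows N

  -- det vanishes whenever two rows agree.  Two lower rows are inherited by every minor; row 0
  -- and a row j+2 are reduced to rows 0 and 1 by exchanging rows 1 and j+2.
  det-alternating : ∀ {n} (i j : Fin n) → i ≢ j → AlternatingIn det i j
  det-alternating-below : ∀ {n} (i j : Fin n) → i ≢ j → AlternatingIn {suc n} det (suc i) (suc j)
  det-alternating-first : ∀ {n} (j : Fin (suc n)) → AlternatingIn {suc (suc n)} det zero (suc j)

  det-alternating-below i j i≢j N rows = Σ-zero _ (λ k →
    trans (*-congˡ {sgn k * N zero k} (det-alternating i j i≢j (minor k N) (λ c → rows (punchIn k c)))) (zeroʳ _))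

  det-alternating-first zero = det-alternating₀₁
  det-alternating-first {suc n} (suc j) N rows₀ = -x≈0⇒x≈0 (begin
    - det N
      ≈⟨ sym (swap-antisymmetric det det-cong (λ ()) (det-linear (suc zero)) (det-linear (suc (suc j)))
                                 (det-alternating-below zero (suc j) (λ ())) N) ⟩
    det (swapAt N (suc zero) (suc (suc j)))
      ≈⟨ det-alternating₀₁ (swapAt N (suc zero) (suc (suc j))) rows₀ ⟩
    0# ∎)

  det-alternating zero    zero    0≢0 = ⊥-elim (0≢0 ≡.refl)
  det-alternating {suc zero} zero (suc ()) _
  det-alternating {suc (suc n)} zero (suc j) _ = det-alternating-first j
  det-alternating {suc zero} (suc ()) zero _
  det-alternating {suc (suc n)} (suc i) zero _ N rows = det-alternating-first i N (sym ∘ rows)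
  det-alternating (suc i) (suc j) i≢j = det-alternating-below i j (i≢j ∘ ≡.cong suc)

  δ : ∀ {n} → Mat n
  δ zero    zero    = 1#
  δ zero    (suc b) = 0#
  δ (suc a) zero    = 0#
  δ (suc a) (suc b) = δ a b

  δ-diag : ∀ {n} (a : Fin n) → δ a a ≡ 1#
  δ-diag zero    = ≡.refl
  δ-diag (suc a) = δ-diag a

  δ-off : ∀ {n} (a b : Fin n) → a ≢ b → δ a b ≡ 0#
  δ-off zero    zero    a≢b = ⊥-elim (a≢b ≡.refl)
  δ-off zero    (suc b) a≢b = ≡.refl
  δ-off (suc a) zero    a≢b = ≡.refl
  δ-off (suc a) (suc b) a≢b = δ-off a b (a≢b ∘ ≡.cong suc)

  δ-sym : ∀ {n} (a b : Fin n) → δ a b ≡ δ b a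
  δ-sym zero    zero    = ≡.refl
  δ-sym zero    (suc b) = ≡.refl
  δ-sym (suc a) zero    = ≡.refl
  δ-sym (suc a) (suc b) = δ-sym a b

  Σ-δ : ∀ {n} (f : Fin n → Carrier) c → sumFin (λ k → f k * δ k c) ≈ f c
  Σ-δ f c = trans (Σ-single (λ k → f k * δ k c) c off-diagonal) (trans (*-congˡ (reflexive (δ-diag c))) (*-identityʳ _))
    where
    off-diagonal : ∀ k → k ≢ c → f k * δ k c ≈ 0#
    off-diagonal k k≢c = trans (*-congˡ (reflexive (δ-off k c k≢c))) (zeroʳ _)

  Σ-δˡ : ∀ {n} (f : Fin n → Carrier) c → sumFin (λ k → δ c k * f k) ≈ f c
  Σ-δˡ f c = trans (Σ-cong (λ k → trans (*-comm _ _) (*-congˡ (reflexive (δ-sym c k))))) (Σ-δ f c)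

  det-δ : ∀ {n} → det (δ {n}) ≈ 1#
  det-δ {zero}  = refl
  det-δ {suc n} = begin
    (1# * 1#) * det (δ {n}) + sumFin {n} (λ j → (sgn (suc j) * 0#) * det (minor (suc j) δ))
      ≈⟨ +-cong (*-congˡ (det-δ {n}))
                (Σ-zero {n} _ (λ j → trans (*-congʳ (zeroʳ (sgn (suc j)))) (zeroˡ (det (minor (suc j) δ))))) ⟩
    (1# * 1#) * 1# + 0#
      ≈⟨ solve 0 (con 1 :* con 1 :* con 1 :+ con 0 := con 1) refl ⟩
    1# ∎

  -- Uniqueness: a multilinear alternating form that vanishes at δ vanishes everywhere.
  -- Expanding the rows of M one at a time in the unit rows reduces to matrices of unit
  -- rows; such a matrix has two equal rows or is a row permutation of δ.

  record MultilinearAlternating {n} (ψ : Mat n → Carrier) : Set (c Level.⊔ ℓ) where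
    field
      congruent   : Congruent ψ
      linear      : ∀ p → LinearIn ψ p
      alternating : ∀ i j → i ≢ j → AlternatingIn ψ i j

  miss⇒collision : ∀ {n} (k : Fin n → Fin n) p → (∀ j → k j ≢ p) →
    ∃ λ i → ∃ λ j → (i ≢ j) × (k i ≡ k j)
  miss⇒collision {suc n} k p miss with FP.pigeonhole (ℕP.n<1+n n) (λ a → punchOut (miss a ∘ ≡.sym))
  ... | i , j , i<j , same = i , j , FP.<⇒≢ i<j , FP.punchOut-injective (miss i ∘ ≡.sym) (miss j ∘ ≡.sym) same

  FixesBelow : ∀ {n} → ℕ → (Fin n → Fin n) → Set
  FixesBelow m k = ∀ i → toℕ i ℕ.< m → k i ≡ i

  fixes-extend : ∀ {n m} (p : Fin n) → toℕ p ≡ m → ∀ k → FixesBelow m k → k p ≡ p → FixesBelow (suc m) k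
  fixes-extend p toℕp k below at-p i i<m+1 with ℕP.m≤n⇒m<n∨m≡n (ℕP.≤-pred i<m+1)
  ... | inj₁ i<m = below i i<m
  ... | inj₂ i≡m rewrite FP.toℕ-injective {i = i} {j = p} (≡.trans i≡m (≡.sym toℕp)) = at-p

  swap-fixes : ∀ {n m} (p : Fin n) → toℕ p ≡ m → ∀ k → FixesBelow m k → ∀ {j} → j ≢ p → k j ≡ p →
    FixesBelow (suc m) (swapAt k p j)
  swap-fixes {m = m} p toℕp k fixed {j} j≢p kj≡p = fixes-extend p toℕp (swapAt k p j) below at-p
    where
    below-p : ∀ i → toℕ i ℕ.< m → i ≢ p
    below-p i i<m i≡p = ℕP.<-irrefl (≡.trans (≡.cong toℕ i≡p) toℕp) i<m
    below : ∀ i → toℕ i ℕ.< m → swapAt k p j i ≡ i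
    below i i<m = ≡.trans (≔-other _ (k p) i i≢j) (≡.trans (≔-other k (k j) i (below-p i i<m)) (fixed i i<m))
      where
      i≢j : i ≢ j
      i≢j ≡.refl = below-p i i<m (≡.trans (≡.sym (fixed i i<m)) kj≡p)
    at-p : swapAt k p j p ≡ p
    at-p = ≡.trans (≔-other _ (k p) p (j≢p ∘ ≡.sym)) (≡.trans (≔-same k p (k j)) kj≡p)

  module Uniqueness {n} {ψ : Mat n → Carrier} (form : MultilinearAlternating ψ) (ψδ≈0 : ψ δ ≈ 0#) where
    open MultilinearAlternating form

    unitRows : (Fin n → Fin n) → Mat n
    unitRows k a = δ (k a)

    unitRows-swap : ∀ k {p j} → p ≢ j → ψ (unitRows (swapAt k p j)) ≈ - ψ (unitRows k)
    unitRows-swap k p≢j = trans (congruent (≡⇒≈ₘ (swapAt-map δ k _ _)))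
      (swap-antisymmetric ψ congruent p≢j (linear _) (linear _) (alternating _ _ p≢j) (unitRows k))

    -- If k fixes every position, unitRows k is δ.
    unitRows-identity : ∀ k → FixesBelow n k → ψ (unitRows k) ≈ 0#
    unitRows-identity k fixed = trans (congruent (≡⇒≈ₘ (λ a → ≡.cong δ (fixed a (FP.toℕ<n a))))) ψδ≈0

    -- Sorting the unit rows into place one position at a time: if k fixes the positions
    -- below m, either some k j hits m (swap it into place, which only flips the sign) or
    -- k is not injective (two equal rows).
    unitRows-sorted : ∀ r m → r ℕ.+ m ≡ n → ∀ k → FixesBelow m k → ψ (unitRows k) ≈ 0#
    unitRows-sorted zero    m ≡.refl k fixed = unitRows-identity k fixed
    unitRows-sorted (suc r) m r+m≡n  k fixed = by-cases (FP.any? (λ j → k j F.≟ p))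
      where
      m<n : m ℕ.< n
      m<n = ≡.subst (m ℕ.<_) r+m≡n (ℕP.m<n+m m (ℕ.s≤s ℕ.z≤n))
      p : Fin n
      p = F.fromℕ< m<n
      sorted′ : ∀ k′ → FixesBelow (suc m) k′ → ψ (unitRows k′) ≈ 0#
      sorted′ = unitRows-sorted r (suc m) (≡.trans (ℕP.+-suc r m) r+m≡n)
      by-cases : Dec (∃ λ j → k j ≡ p) → ψ (unitRows k) ≈ 0#
      by-cases (no miss) with miss⇒collision k p (λ j kj≡p → miss (j , kj≡p))
      ... | i , j , i≢j , ki≡kj = alternating i j i≢j (unitRows k) (λ b → reflexive (≡.cong (λ t → δ t b) ki≡kj))
      by-cases (yes (j , kj≡p)) with j F.≟ p
      ... | yes ≡.refl = sorted′ k (fixes-extend p (FP.toℕ-fromℕ< m<n) k fixed kj≡p)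
      ... | no j≢p     = -x≈0⇒x≈0 (trans (sym (unitRows-swap k (j≢p ∘ ≡.sym)))
                           (sorted′ (swapAt k p j) (swap-fixes p (FP.toℕ-fromℕ< m<n) k fixed j≢p kj≡p)))

    unitRows-vanish : ∀ k → ψ (unitRows k) ≈ 0#
    unitRows-vanish k = unitRows-sorted n 0 (ℕP.+-identityʳ n) k (λ i ())

    zero-row : ∀ N p → ψ (N [ p ]≔ const 0#) ≈ 0#
    zero-row N p = x+x≈x⇒x≈0 _ (sym (begin
      ψ (N [ p ]≔ const 0#)
        ≈⟨ congruent (≔-cong N p (λ _ → sym (trans (+-identityʳ _) (zeroʳ 1#)))) ⟩
      ψ (N [ p ]≔ (λ _ → 1# * 0# + 0#))
        ≈⟨ linear p N 1# (const 0#) (const 0#) ⟩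
      1# * ψ (N [ p ]≔ const 0#) + ψ (N [ p ]≔ const 0#)
        ≈⟨ +-congʳ (*-identityˡ _) ⟩
      ψ (N [ p ]≔ const 0#) + ψ (N [ p ]≔ const 0#) ∎))

    row-expansion : ∀ {q} N p (a : Fin q → Carrier) (u : Fin q → Fin n → Carrier) →
      ψ (N [ p ]≔ (λ c → sumFin (λ t → a t * u t c))) ≈ sumFin (λ t → a t * ψ (N [ p ]≔ u t))
    row-expansion {zero}  N p a u = zero-row N p
    row-expansion {suc q} N p a u = begin
      ψ (N [ p ]≔ (λ c → a zero * u zero c + rest c))
        ≈⟨ linear p N (a zero) (u zero) rest ⟩
      a zero * ψ (N [ p ]≔ u zero) + ψ (N [ p ]≔ rest)
        ≈⟨ +-congˡ (row-expansion N p (a ∘ suc) (u ∘ suc)) ⟩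
      a zero * ψ (N [ p ]≔ u zero) + sumFin (λ t → a (suc t) * ψ (N [ p ]≔ u (suc t))) ∎
      where
      rest = λ c → sumFin (λ t → a (suc t) * u (suc t) c)

    prefixRows : ℕ → Mat n → (Fin n → Fin n) → Mat n
    prefixRows t M k a = choose (toℕ a ℕ.<? t)
      where
      choose : Dec (toℕ a ℕ.< t) → Fin n → Carrier
      choose (yes _) = M a
      choose (no _)  = δ (k a)

    prefix-below : ∀ t M k a → toℕ a ℕ.< t → prefixRows t M k a ≡ M a
    prefix-below t M k a a<t with toℕ a ℕ.<? t
    ... | yes _   = ≡.refl
    ... | no a≮t = ⊥-elim (a≮t a<t)

    prefix-above : ∀ t M k a → ¬ (toℕ a ℕ.< t) → prefixRows t M k a ≡ δ (k a)
    prefix-above t M k a a≮t with toℕ a ℕ.<? t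
    ... | yes a<t = ⊥-elim (a≮t a<t)
    ... | no _    = ≡.refl

    prefix-agree : ∀ t M k k′ a → (¬ (toℕ a ℕ.< t) → k a ≡ k′ a) → prefixRows t M k a ≡ prefixRows t M k′ a
    prefix-agree t M k k′ a same with toℕ a ℕ.<? t
    ... | yes _   = ≡.refl
    ... | no a≮t = ≡.cong δ (same a≮t)

    -- Expanding row t of M in the unit rows: every prefixRows matrix is annihilated by ψ.
    prefix-vanish : ∀ t → t ℕ.≤ n → ∀ M k → ψ (prefixRows t M k) ≈ 0#
    prefix-vanish zero    _   M k = trans (congruent (≡⇒≈ₘ (λ a → prefix-above 0 M k a (λ ())))) (unitRows-vanish k)
    prefix-vanish (suc t) t<n M k = begin
      ψ (prefixRows (suc t) M k)
        ≈⟨ congruent expand-row-p ⟩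
      ψ (prefixRows t M k [ p ]≔ (λ c → sumFin (λ c′ → M p c′ * δ c′ c)))
        ≈⟨ row-expansion (prefixRows t M k) p (M p) δ ⟩
      sumFin (λ c′ → M p c′ * ψ (prefixRows t M k [ p ]≔ δ c′))
        ≈⟨ Σ-zero _ (λ c′ → trans (*-congˡ (vanish c′)) (zeroʳ _)) ⟩
      0# ∎
      where
      p = F.fromℕ< t<n
      toℕp : toℕ p ≡ t
      toℕp = FP.toℕ-fromℕ< t<n
      p≮t : ¬ (toℕ p ℕ.< t)
      p≮t = ℕP.<-irrefl toℕp
      p<t+1 : toℕ p ℕ.< suc t
      p<t+1 = ≡.subst (ℕ._< suc t) (≡.sym toℕp) (ℕP.n<1+n t)
      same-below : ∀ a → a ≢ p → prefixRows (suc t) M k a ≡ prefixRows t M k a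
      same-below a a≢p with toℕ a ℕ.<? suc t | toℕ a ℕ.<? t
      ... | yes _ | yes _ = ≡.refl
      ... | no _  | no _  = ≡.refl
      ... | no a≮t+1 | yes a<t = ⊥-elim (a≮t+1 (ℕP.m<n⇒m<1+n a<t))
      ... | yes a<t+1 | no a≮t with ℕP.m≤n⇒m<n∨m≡n (ℕP.≤-pred a<t+1)
      ...   | inj₁ a<t = ⊥-elim (a≮t a<t)
      ...   | inj₂ a≡t = ⊥-elim (a≢p (FP.toℕ-injective (≡.trans a≡t (≡.sym toℕp))))
      expand-row-p : prefixRows (suc t) M k ≈ₘ prefixRows t M k [ p ]≔ (λ c → sumFin (λ c′ → M p c′ * δ c′ c))
      expand-row-p = ≔-intro p _
        (λ c → trans (reflexive (≡.cong (λ row → row c) (prefix-below (suc t) M k p p<t+1))) (sym (Σ-δ (M p) c)))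
        (λ a a≢p c → reflexive (≡.cong (λ row → row c) (same-below a a≢p)))
      vanish : ∀ c′ → ψ (prefixRows t M k [ p ]≔ δ c′) ≈ 0#
      vanish c′ = trans (congruent (λ a b → sym (rows a b))) (prefix-vanish t (ℕP.<⇒≤ t<n) M (k [ p ]≔ c′))
        where
        rows : prefixRows t M (k [ p ]≔ c′) ≈ₘ prefixRows t M k [ p ]≔ δ c′
        rows = ≔-intro p (δ c′)
          (λ c → reflexive (≡.cong (λ row → row c)
                   (≡.trans (prefix-above t M _ p p≮t) (≡.cong δ (≔-same k p c′)))))
          (λ a a≢p c → reflexive (≡.cong (λ row → row c) (prefix-agree t M _ k a (λ _ → ≔-other k c′ a a≢p))))

    vanishes : ∀ M → ψ M ≈ 0#
    vanishes M = trans (congruent (≡⇒≈ₘ (λ a → ≡.sym (prefix-below n M (λ x → x) a (FP.toℕ<n a)))))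
                       (prefix-vanish n ℕP.≤-refl M (λ x → x))

  -- Multiplicativity of the determinant.

  infixl 7 _⊙_
  _⊙_ : ∀ {n} → Mat n → Mat n → Mat n
  (A ⊙ B) i j = sumFin (λ k → A i k * B k j)

  ⊙-cong : ∀ {n} {A A′ : Mat n} (B : Mat n) → A ≈ₘ A′ → A ⊙ B ≈ₘ A′ ⊙ B
  ⊙-cong B A≈A′ i j = Σ-cong (λ k → *-congʳ (A≈A′ i k))

  ⊙-≔ : ∀ {n} (N B : Mat n) p r → (N [ p ]≔ r) ⊙ B ≈ₘ (N ⊙ B) [ p ]≔ (λ c → sumFin (λ k → r k * B k c))
  ⊙-≔ N B p r = ≔-intro p _
    (λ c → Σ-cong (λ k → *-congʳ (reflexive (≡.cong (λ row → row k) (≔-same N p r)))))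
    (λ a a≢p c → Σ-cong (λ k → *-congʳ (reflexive (≡.cong (λ row → row k) (≔-other N r a a≢p)))))

  -- For fixed B, A ↦ det (A ⊙ B) - det A · det B is multilinear, alternating and vanishes at δ.
  module ProductDefect {n} (B : Mat n) where
    φ : Mat n → Carrier
    φ A = det (A ⊙ B) - det A * det B

    row·B : (Fin n → Carrier) → Fin n → Carrier
    row·B r c = sumFin (λ k → r k * B k c)

    row·B-linear : ∀ a u v c → row·B (λ k → a * u k + v k) c ≈ a * row·B u c + row·B v c
    row·B-linear a u v c = Σ-linear _ _ _ a (λ k →
      solve 4 (λ a u v b → (a :* u :+ v) :* b := a :* (u :* b) :+ v :* b) refl a (u k) (v k) (B k c))

    ⊙-linear : ∀ p → LinearIn (λ A → det (A ⊙ B)) p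
    ⊙-linear p N a u v = begin
      det ((N [ p ]≔ (λ k → a * u k + v k)) ⊙ B)
        ≈⟨ det-cong (⊙-≔ N B p _) ⟩
      det ((N ⊙ B) [ p ]≔ row·B (λ k → a * u k + v k))
        ≈⟨ det-cong (≔-cong (N ⊙ B) p (row·B-linear a u v)) ⟩
      det ((N ⊙ B) [ p ]≔ (λ c → a * row·B u c + row·B v c))
        ≈⟨ det-linear p (N ⊙ B) a (row·B u) (row·B v) ⟩
      a * det ((N ⊙ B) [ p ]≔ row·B u) + det ((N ⊙ B) [ p ]≔ row·B v)
        ≈⟨ sym (+-cong (*-congˡ (det-cong (⊙-≔ N B p u))) (det-cong (⊙-≔ N B p v))) ⟩
      a * det ((N [ p ]≔ u) ⊙ B) + det ((N [ p ]≔ v) ⊙ B) ∎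

    defect-linear : ∀ a {X Xu Xv x xu xv} d → X ≈ a * Xu + Xv → x ≈ a * xu + xv →
      X - x * d ≈ a * (Xu - xu * d) + (Xv - xv * d)
    defect-linear a {X} {Xu} {Xv} {x} {xu} {xv} d X≈ x≈ = begin
      X - x * d                                    ≈⟨ +-cong X≈ (-‿cong (*-congʳ x≈)) ⟩
      (a * Xu + Xv) - (a * xu + xv) * d            ≈⟨ +-congˡ negate ⟩
      (a * Xu + Xv) + (a * - (xu * d) + - (xv * d)) ≈⟨ solve 5 (λ a Xu Xv yu yv → (a :* Xu :+ Xv) :+ (a :* yu :+ yv)
                                                        := a :* (Xu :+ yu) :+ (Xv :+ yv)) refl a Xu Xv _ _ ⟩
      a * (Xu - xu * d) + (Xv - xv * d)            ∎
      where
      negate : - ((a * xu + xv) * d) ≈ a * - (xu * d) + - (xv * d)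
      negate = begin
        - ((a * xu + xv) * d)          ≈⟨ -‿cong (solve 4 (λ a y z d → (a :* y :+ z) :* d := a :* (y :* d) :+ z :* d)
                                                     refl a xu xv d) ⟩
        - (a * (xu * d) + xv * d)      ≈⟨ sym (-‿+-comm _ _) ⟩
        - (a * (xu * d)) + - (xv * d)  ≈⟨ +-congʳ (-‿distribʳ-* a _) ⟩
        a * - (xu * d) + - (xv * d)    ∎

    form : MultilinearAlternating φ
    form = record
      { congruent   = λ A≈A′ → +-cong (det-cong (⊙-cong B A≈A′)) (-‿cong (*-congʳ (det-cong A≈A′)))
      ; linear      = λ p N a u v → defect-linear a (det B) (⊙-linear p N a u v) (det-linear p N a u v)
      ; alternating = λ i j i≢j N rows → begin
          det (N ⊙ B) - det N * det B
            ≈⟨ +-cong (det-alternating i j i≢j (N ⊙ B) (λ c → Σ-cong (λ k → *-congʳ (rows k))))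
                      (-‿cong (*-congʳ (det-alternating i j i≢j N rows))) ⟩
          0# - 0# * det B
            ≈⟨ trans (+-congˡ (trans (-‿cong (zeroˡ _)) -0#≈0#)) (+-identityʳ 0#) ⟩
          0# ∎
      }

    φ-δ : φ δ ≈ 0#
    φ-δ = begin
      det (δ ⊙ B) - det (δ {n}) * det B
        ≈⟨ +-cong (det-cong (λ a c → Σ-δˡ (λ k → B k c) a)) (-‿cong (*-congʳ (det-δ {n}))) ⟩
      det B - 1# * det B
        ≈⟨ +-congˡ (-‿cong (*-identityˡ _)) ⟩
      det B - det B
        ≈⟨ -‿inverseʳ _ ⟩
      0# ∎

  det-⊙ : ∀ {n} (A B : Mat n) → det (A ⊙ B) ≈ det A * det B
  det-⊙ A B = x∙y⁻¹≈ε⇒x≈y _ _ (Uniqueness.vanishes form φ-δ A)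
    where open ProductDefect B

  -- Polynomial maps: evaluation is a congruence, and the chain rule holds for formal
  -- derivatives of a substitution.

  eval-cong : ∀ {n} (p : Pol n) {x y : Pt n} → x ≈ᵥ y → eval p x ≈ eval p y
  eval-cong (con a) x≈y = refl
  eval-cong (var i) x≈y = x≈y i
  eval-cong (p ⊕ q) x≈y = +-cong (eval-cong p x≈y) (eval-cong q x≈y)
  eval-cong (p ⊗ q) x≈y = *-cong (eval-cong p x≈y) (eval-cong q x≈y)

  apply-cong : ∀ {n} (F : PolyMap n) {x y : Pt n} → x ≈ᵥ y → apply F x ≈ᵥ apply F y
  apply-cong F x≈y i = eval-cong (F i) x≈y

  jacobian-cong : ∀ {n} (F : PolyMap n) {x y : Pt n} → x ≈ᵥ y → jacobian F x ≈ₘ jacobian F y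
  jacobian-cong F x≈y i j = eval-cong (∂ j (F i)) x≈y

  substitute : ∀ {n} → Pol n → PolyMap n → Pol n
  substitute (con a) G = con a
  substitute (var i) G = G i
  substitute (p ⊕ q) G = substitute p G ⊕ substitute q G
  substitute (p ⊗ q) G = substitute p G ⊗ substitute q G

  eval-substitute : ∀ {n} (p : Pol n) G x → eval (substitute p G) x ≈ eval p (apply G x)
  eval-substitute (con a) G x = refl
  eval-substitute (var i) G x = refl
  eval-substitute (p ⊕ q) G x = +-cong (eval-substitute p G x) (eval-substitute q G x)
  eval-substitute (p ⊗ q) G x = *-cong (eval-substitute p G x) (eval-substitute q G x)

  ∂-var : ∀ {n} (i k : Fin n) y → eval (∂ k (var i)) y ≈ δ i k
  ∂-var i k y with i F.≟ k
  ... | yes ≡.refl = reflexive (≡.sym (δ-diag i))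
  ... | no i≢k     = reflexive (≡.sym (δ-off i k i≢k))

  chain-rule : ∀ {n} (p : Pol n) G j x →
    eval (∂ j (substitute p G)) x ≈ sumFin (λ k → eval (∂ k p) (apply G x) * eval (∂ j (G k)) x)
  chain-rule {n} (con a) G j x = sym (Σ-zero {n} _ (λ k → zeroˡ _))
  chain-rule (var i) G j x =
    sym (trans (Σ-cong (λ k → *-congʳ (∂-var i k (apply G x)))) (Σ-δˡ (λ k → eval (∂ j (G k)) x) i))
  chain-rule {n} (p ⊕ q) G j x = begin
    eval (∂ j (substitute p G)) x + eval (∂ j (substitute q G)) x  ≈⟨ +-cong (chain-rule p G j x) (chain-rule q G j x) ⟩
    sumFin (λ k → P′ k * J k) + sumFin (λ k → Q′ k * J k)          ≈⟨ sym (Σ-+ {n} _ _) ⟩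
    sumFin (λ k → P′ k * J k + Q′ k * J k)                         ≈⟨ Σ-cong (λ k → sym (distribʳ (J k) _ _)) ⟩
    sumFin (λ k → (P′ k + Q′ k) * J k)                             ∎
    where
    P′ = λ k → eval (∂ k p) (apply G x)
    Q′ = λ k → eval (∂ k q) (apply G x)
    J = λ k → eval (∂ j (G k)) x
  chain-rule {n} (p ⊗ q) G j x = begin
    eval (∂ j (substitute p G)) x * eval (substitute q G) x + eval (substitute p G) x * eval (∂ j (substitute q G)) x
      ≈⟨ +-cong (*-cong (chain-rule p G j x) (eval-substitute q G x)) (*-cong (eval-substitute p G x) (chain-rule q G j x)) ⟩
    sumFin (λ k → P′ k * J k) * qv + pv * sumFin (λ k → Q′ k * J k)
      ≈⟨ +-cong (Σ-*ʳ qv (λ k → P′ k * J k)) (Σ-*ˡ pv (λ k → Q′ k * J k)) ⟩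
    sumFin (λ k → P′ k * J k * qv) + sumFin (λ k → pv * (Q′ k * J k))
      ≈⟨ sym (Σ-+ {n} _ _) ⟩
    sumFin (λ k → P′ k * J k * qv + pv * (Q′ k * J k))
      ≈⟨ Σ-cong (λ k → solve 5 (λ a b c d e → a :* b :* c :+ d :* (e :* b) := (a :* c :+ d :* e) :* b) refl
                         (P′ k) (J k) qv pv (Q′ k)) ⟩
    sumFin (λ k → (P′ k * qv + pv * Q′ k) * J k) ∎
    where
    P′ = λ k → eval (∂ k p) (apply G x)
    Q′ = λ k → eval (∂ k q) (apply G x)
    J = λ k → eval (∂ j (G k)) x
    pv = eval p (apply G x)
    qv = eval q (apply G x)

  compose : ∀ {n} → PolyMap n → PolyMap n → PolyMap n
  compose F G i = substitute (F i) G

  jacobian-compose : ∀ {n} (F G : PolyMap n) x → jacobian (compose F G) x ≈ₘ jacobian F (apply G x) ⊙ jacobian G x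
  jacobian-compose F G x i j = chain-rule (F i) G j x

  -- Univariate polynomials in t, as ascending coefficient lists, evaluated by Horner's rule.
  -- They serve to restrict a polynomial in n variables to a line.

  horner : List Carrier → Carrier → Carrier
  horner []      t = 0#
  horner (a ∷ A) t = a + t * horner A t

  _⊞_ : List Carrier → List Carrier → List Carrier
  []      ⊞ B       = B
  (a ∷ A) ⊞ []      = a ∷ A
  (a ∷ A) ⊞ (b ∷ B) = (a + b) ∷ (A ⊞ B)

  scale : Carrier → List Carrier → List Carrier
  scale a []      = []
  scale a (b ∷ B) = a * b ∷ scale a B

  _⊠_ : List Carrier → List Carrier → List Carrier
  []      ⊠ B = []
  (a ∷ A) ⊠ B = scale a B ⊞ (0# ∷ (A ⊠ B))

  coeff₀ coeff₁ : List Carrier → Carrier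
  coeff₀ []      = 0#
  coeff₀ (a ∷ _) = a
  coeff₁ []      = 0#
  coeff₁ (_ ∷ A) = coeff₀ A

  horner-⊞ : ∀ A B t → horner (A ⊞ B) t ≈ horner A t + horner B t
  horner-⊞ []      B       t = sym (+-identityˡ _)
  horner-⊞ (a ∷ A) []      t = sym (+-identityʳ _)
  horner-⊞ (a ∷ A) (b ∷ B) t = trans (+-congˡ (*-congˡ (horner-⊞ A B t)))
    (solve 5 (λ a b t x y → (a :+ b) :+ t :* (x :+ y) := (a :+ t :* x) :+ (b :+ t :* y)) refl a b t _ _)

  horner-scale : ∀ a B t → horner (scale a B) t ≈ a * horner B t
  horner-scale a []      t = sym (zeroʳ a)
  horner-scale a (b ∷ B) t = trans (+-congˡ (*-congˡ (horner-scale a B t)))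
    (solve 4 (λ a b t x → a :* b :+ t :* (a :* x) := a :* (b :+ t :* x)) refl a b t _)

  horner-⊠ : ∀ A B t → horner (A ⊠ B) t ≈ horner A t * horner B t
  horner-⊠ []      B t = sym (zeroˡ _)
  horner-⊠ (a ∷ A) B t = begin
    horner (scale a B ⊞ (0# ∷ (A ⊠ B))) t               ≈⟨ horner-⊞ (scale a B) _ t ⟩
    horner (scale a B) t + (0# + t * horner (A ⊠ B) t)  ≈⟨ +-cong (horner-scale a B t)
                                                            (trans (+-identityˡ _) (*-congˡ (horner-⊠ A B t))) ⟩
    a * horner B t + t * (horner A t * horner B t)      ≈⟨ solve 4 (λ a y t x → a :* y :+ t :* (x :* y) := (a :+ t :* x) :* y)
                                                            refl a _ t _ ⟩
    (a + t * horner A t) * horner B t                   ∎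

  coeff₀-⊞ : ∀ A B → coeff₀ (A ⊞ B) ≈ coeff₀ A + coeff₀ B
  coeff₀-⊞ []      B       = sym (+-identityˡ _)
  coeff₀-⊞ (a ∷ A) []      = sym (+-identityʳ _)
  coeff₀-⊞ (a ∷ A) (b ∷ B) = refl

  coeff₁-⊞ : ∀ A B → coeff₁ (A ⊞ B) ≈ coeff₁ A + coeff₁ B
  coeff₁-⊞ []      B       = sym (+-identityˡ _)
  coeff₁-⊞ (a ∷ A) []      = sym (+-identityʳ _)
  coeff₁-⊞ (a ∷ A) (b ∷ B) = coeff₀-⊞ A B

  coeff₀-scale : ∀ a B → coeff₀ (scale a B) ≈ a * coeff₀ B
  coeff₀-scale a []      = sym (zeroʳ a)
  coeff₀-scale a (b ∷ B) = refl

  coeff₁-scale : ∀ a B → coeff₁ (scale a B) ≈ a * coeff₁ B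
  coeff₁-scale a []      = sym (zeroʳ a)
  coeff₁-scale a (b ∷ B) = coeff₀-scale a B

  coeff₀-⊠ : ∀ A B → coeff₀ (A ⊠ B) ≈ coeff₀ A * coeff₀ B
  coeff₀-⊠ []      B = sym (zeroˡ _)
  coeff₀-⊠ (a ∷ A) B = trans (coeff₀-⊞ (scale a B) _) (trans (+-identityʳ _) (coeff₀-scale a B))

  coeff₁-⊠ : ∀ A B → coeff₁ (A ⊠ B) ≈ coeff₀ A * coeff₁ B + coeff₁ A * coeff₀ B
  coeff₁-⊠ []      B = sym (trans (+-cong (zeroˡ _) (zeroˡ _)) (+-identityʳ 0#))
  coeff₁-⊠ (a ∷ A) B = trans (coeff₁-⊞ (scale a B) _) (+-cong (coeff₁-scale a B) (coeff₀-⊠ A B))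

  -- Restriction of a polynomial to the line through x in direction j: horner (restrict p) t is
  -- p at x + t·eⱼ, so the constant and linear coefficients are p(x) and ∂ⱼp(x).
  module Line {n} (j : Fin n) (x : Pt n) where
    restrict-var : ∀ i → Dec (i ≡ j) → List Carrier
    restrict-var i (yes _) = x i ∷ 1# ∷ []
    restrict-var i (no _)  = x i ∷ []

    restrict : Pol n → List Carrier
    restrict (con a) = a ∷ []
    restrict (var i) = restrict-var i (i F.≟ j)
    restrict (p ⊕ q) = restrict p ⊞ restrict q
    restrict (p ⊗ q) = restrict p ⊠ restrict q

    shift : Carrier → Pt n
    shift t = x [ j ]≔ (x j + t)

    horner-restrict : ∀ p t → horner (restrict p) t ≈ eval p (shift t)
    horner-restrict (con a) t = trans (+-congˡ (zeroʳ t)) (+-identityʳ a)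
    horner-restrict (var i) t with i F.≟ j
    ... | yes ≡.refl = trans (+-congˡ (trans (*-congˡ (trans (+-congˡ (zeroʳ t)) (+-identityʳ 1#))) (*-identityʳ t)))
                             (reflexive (≡.sym (≔-same x i (x i + t))))
    ... | no i≢j     = trans (trans (+-congˡ (zeroʳ t)) (+-identityʳ _)) (reflexive (≡.sym (≔-other x (x j + t) i i≢j)))
    horner-restrict (p ⊕ q) t = trans (horner-⊞ (restrict p) (restrict q) t) (+-cong (horner-restrict p t) (horner-restrict q t))
    horner-restrict (p ⊗ q) t = trans (horner-⊠ (restrict p) (restrict q) t) (*-cong (horner-restrict p t) (horner-restrict q t))

    coeff₀-restrict : ∀ p → coeff₀ (restrict p) ≈ eval p x
    coeff₀-restrict (con a) = refl
    coeff₀-restrict (var i) with i F.≟ j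
    ... | yes _ = refl
    ... | no _  = refl
    coeff₀-restrict (p ⊕ q) = trans (coeff₀-⊞ (restrict p) (restrict q)) (+-cong (coeff₀-restrict p) (coeff₀-restrict q))
    coeff₀-restrict (p ⊗ q) = trans (coeff₀-⊠ (restrict p) (restrict q)) (*-cong (coeff₀-restrict p) (coeff₀-restrict q))

    coeff₁-restrict : ∀ p → coeff₁ (restrict p) ≈ eval (∂ j p) x
    coeff₁-restrict (con a) = refl
    coeff₁-restrict (var i) with i F.≟ j
    ... | yes _ = refl
    ... | no _  = refl
    coeff₁-restrict (p ⊕ q) = trans (coeff₁-⊞ (restrict p) (restrict q)) (+-cong (coeff₁-restrict p) (coeff₁-restrict q))
    coeff₁-restrict (p ⊗ q) = trans (coeff₁-⊠ (restrict p) (restrict q))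
      (trans (+-cong (*-cong (coeff₀-restrict p) (coeff₁-restrict q)) (*-cong (coeff₁-restrict p) (coeff₀-restrict q)))
             (+-comm _ _))

  -- Identity theorem.  A univariate polynomial vanishing at the points 0, 1, 2, … (distinct
  -- by characteristic 0) has zero coefficients; this is proved by synthetic division.

  divide : Carrier → List Carrier → List Carrier × Carrier
  divide t₀ []          = [] , 0#
  divide t₀ (a ∷ [])    = [] , a
  divide t₀ (a ∷ b ∷ A) = divide-step (divide t₀ (b ∷ A))
    where
    divide-step : List Carrier × Carrier → List Carrier × Carrier
    divide-step (Q , r) = (r ∷ Q) , a + t₀ * r

  horner-divide : ∀ t₀ A t → horner A t ≈ (t - t₀) * horner (proj₁ (divide t₀ A)) t + proj₂ (divide t₀ A)
  horner-divide t₀ []          t = sym (trans (+-identityʳ _) (zeroʳ _))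
  horner-divide t₀ (a ∷ [])    t =
    trans (trans (+-congˡ (zeroʳ t)) (+-identityʳ a)) (sym (trans (+-congʳ (zeroʳ _)) (+-identityˡ a)))
  horner-divide t₀ (a ∷ b ∷ A) t = begin
    a + t * horner (b ∷ A) t
      ≈⟨ +-congˡ (*-congˡ (horner-divide t₀ (b ∷ A) t)) ⟩
    a + t * ((t - t₀) * U + r)
      ≈⟨ sym (+-identityʳ _) ⟩
    a + t * ((t - t₀) * U + r) + 0#
      ≈⟨ +-congˡ (sym t₀r-t₀r≈0) ⟩
    a + t * ((t - t₀) * U + r) + (t₀ * r + - t₀ * r)
      ≈⟨ solve 6 (λ a t n t₀ U r → a :+ t :* ((t :+ n) :* U :+ r) :+ (t₀ :* r :+ n :* r)
                                  := (t :+ n) :* (r :+ t :* U) :+ (a :+ t₀ :* r)) refl a t (- t₀) t₀ U r ⟩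
    (t - t₀) * (r + t * U) + (a + t₀ * r) ∎
    where
    U = horner (proj₁ (divide t₀ (b ∷ A))) t
    r = proj₂ (divide t₀ (b ∷ A))
    t₀r-t₀r≈0 : t₀ * r + - t₀ * r ≈ 0#
    t₀r-t₀r≈0 = trans (sym (distribʳ r t₀ (- t₀))) (trans (*-congʳ (-‿inverseʳ t₀)) (zeroˡ r))

  length-divide : ∀ t₀ A → length (proj₁ (divide t₀ A)) ≡ ℕ.pred (length A)
  length-divide t₀ []          = ≡.refl
  length-divide t₀ (a ∷ [])    = ≡.refl
  length-divide t₀ (a ∷ b ∷ A) = ≡.cong suc (length-divide t₀ (b ∷ A))

  divide-zero : ∀ t₀ A → All (_≈ 0#) (proj₁ (divide t₀ A)) → proj₂ (divide t₀ A) ≈ 0# → All (_≈ 0#) A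
  divide-zero t₀ []          _          _    = []
  divide-zero t₀ (a ∷ [])    _          a≈0  = a≈0 ∷ []
  divide-zero t₀ (a ∷ b ∷ A) (r≈0 ∷ Q≈0) a+t₀r≈0 = a≈0 ∷ divide-zero t₀ (b ∷ A) Q≈0 r≈0
    where
    a≈0 : a ≈ 0#
    a≈0 = trans (sym (trans (+-congˡ (trans (*-congˡ r≈0) (zeroʳ t₀))) (+-identityʳ a))) a+t₀r≈0

  natToK-+ : ∀ a b → natToK (a ℕ.+ b) ≈ natToK a + natToK b
  natToK-+ zero    b = sym (+-identityˡ _)
  natToK-+ (suc a) b = trans (+-congˡ (natToK-+ a b)) (sym (+-assoc _ _ _))

  natToK-gap : ∀ s i → ¬ (natToK (s ℕ.+ suc i) - natToK s ≈ 0#)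
  natToK-gap s i gap≈0 = char0 i (begin
    natToK (suc i)                               ≈⟨ sym (+-identityˡ _) ⟩
    0# + natToK (suc i)                          ≈⟨ +-congʳ (sym (-‿inverseʳ (natToK s))) ⟩
    (natToK s + - natToK s) + natToK (suc i)     ≈⟨ solve 3 (λ a n b → (a :+ n) :+ b := (a :+ b) :+ n) refl _ _ _ ⟩
    (natToK s + natToK (suc i)) + - natToK s     ≈⟨ +-congʳ (sym (natToK-+ s (suc i))) ⟩
    natToK (s ℕ.+ suc i) - natToK s              ≈⟨ gap≈0 ⟩
    0#                                           ∎)

  vanishing-at-naturals : ∀ N s A → length A ℕ.≤ N → (∀ i → i ℕ.< N → horner A (natToK (s ℕ.+ i)) ≈ 0#) →
    All (_≈ 0#) A
  vanishing-at-naturals N       s []      _  _ = []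
  vanishing-at-naturals (suc N) s (a ∷ A) ≤N vanish =
    divide-zero t₀ (a ∷ A) (vanishing-at-naturals N (suc s) Q Q-short Q-vanish) r≈0
    where
    t₀ = natToK s
    Q = proj₁ (divide t₀ (a ∷ A))
    r = proj₂ (divide t₀ (a ∷ A))
    r≈0 : r ≈ 0#
    r≈0 = begin
      r
        ≈⟨ sym (trans (+-congʳ (trans (*-congʳ (-‿inverseʳ t₀)) (zeroˡ _))) (+-identityˡ r)) ⟩
      (t₀ - t₀) * horner Q t₀ + r
        ≈⟨ sym (horner-divide t₀ (a ∷ A) t₀) ⟩
      horner (a ∷ A) t₀
        ≡⟨ ≡.cong (horner (a ∷ A) ∘ natToK) (≡.sym (ℕP.+-identityʳ s)) ⟩
      horner (a ∷ A) (natToK (s ℕ.+ 0))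
        ≈⟨ vanish 0 (ℕ.s≤s ℕ.z≤n) ⟩
      0# ∎
    Q-short : length Q ℕ.≤ N
    Q-short = ≡.subst (ℕ._≤ N) (≡.sym (length-divide t₀ (a ∷ A))) (ℕP.≤-pred ≤N)
    Q-vanish : ∀ i → i ℕ.< N → horner Q (natToK (suc s ℕ.+ i)) ≈ 0#
    Q-vanish i i<N = cancel (natToK-gap s i ∘ trans (+-congʳ (reflexive (≡.cong natToK (ℕP.+-suc s i))))) (begin
      (t - t₀) * horner Q t              ≈⟨ sym (trans (+-congˡ r≈0) (+-identityʳ _)) ⟩
      (t - t₀) * horner Q t + r          ≈⟨ sym (horner-divide t₀ (a ∷ A) t) ⟩
      horner (a ∷ A) t                   ≡⟨ ≡.cong (horner (a ∷ A) ∘ natToK) (≡.sym (ℕP.+-suc s i)) ⟩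
      horner (a ∷ A) (natToK (s ℕ.+ suc i)) ≈⟨ vanish (suc i) (ℕ.s≤s i<N) ⟩
      0#                                 ∎)
      where t = natToK (suc s ℕ.+ i)

  vanishing⇒zero : ∀ A → (∀ t → horner A t ≈ 0#) → All (_≈ 0#) A
  vanishing⇒zero A vanish = vanishing-at-naturals (length A) 0 A ℕP.≤-refl (λ i _ → vanish _)

  coeff₁-zero : ∀ {A} → All (_≈ 0#) A → coeff₁ A ≈ 0#
  coeff₁-zero []            = refl
  coeff₁-zero (_ ∷ [])      = refl
  coeff₁-zero (_ ∷ b≈0 ∷ _) = b≈0

  ∂-vanish : ∀ {n} (h : Pol n) → (∀ y → eval h y ≈ 0#) → ∀ j x → eval (∂ j h) x ≈ 0#
  ∂-vanish h h≈0 j x = trans (sym (coeff₁-restrict h))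
      (coeff₁-zero (vanishing⇒zero (restrict h) (λ t → trans (horner-restrict h t) (h≈0 (shift t)))))
    where open Line j x

  ∂-unique : ∀ {n} (p q : Pol n) → (∀ y → eval p y ≈ eval q y) → ∀ j x → eval (∂ j p) x ≈ eval (∂ j q) x
  ∂-unique p q p≈q j x = x∙y⁻¹≈ε⇒x≈y _ _ (begin
    eval (∂ j p) x - eval (∂ j q) x
      ≈⟨ +-congˡ (sym (trans (+-congʳ (zeroˡ _)) (trans (+-identityˡ _) (-1*x≈-x _)))) ⟩
    eval (∂ j p) x + (0# * eval q x + - 1# * eval (∂ j q) x)
      ≈⟨ ∂-vanish (p ⊕ (con (- 1#) ⊗ q)) difference≈0 j x ⟩
    0# ∎)
    where
    difference≈0 : ∀ y → eval p y + - 1# * eval q y ≈ 0#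
    difference≈0 y = trans (+-cong (p≈q y) (-1*x≈-x _)) (-‿inverseʳ _)

  -- Products along an orbit.

  prod : (ℕ → Carrier) → ℕ → Carrier
  prod x zero    = 1#
  prod x (suc l) = x l * prod x l

  prod-cong : ∀ {x y} → (∀ i → x i ≈ y i) → ∀ l → prod x l ≈ prod y l
  prod-cong x≈y zero    = refl
  prod-cong x≈y (suc l) = *-cong (x≈y l) (prod-cong x≈y l)

  prod-last : ∀ x l → prod x (suc l) ≈ prod (x ∘ suc) l * x 0
  prod-last x zero    = trans (*-identityʳ _) (sym (*-identityˡ _))
  prod-last x (suc l) = trans (*-congˡ (prod-last x l)) (sym (*-assoc _ _ _))

  prod-rotate : ∀ x l → x l ≈ x 0 → prod (x ∘ suc) l ≈ prod x l
  prod-rotate x zero    _         = refl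
  prod-rotate x (suc l) xl+1≈x0 = trans (*-congʳ xl+1≈x0) (trans (*-comm _ _) (sym (prod-last x l)))

  prod-+ : ∀ x m k → prod x (m ℕ.+ k) ≈ prod (λ i → x (i ℕ.+ k)) m * prod x k
  prod-+ x zero    k = sym (*-identityˡ _)
  prod-+ x (suc m) k = trans (*-congˡ (prod-+ x m k)) (sym (*-assoc _ _ _))

  prod-periodic : ∀ x k → (∀ i → x (i ℕ.+ k) ≈ x i) → ∀ q → prod x (q ℕ.* k) ≈ pow (prod x k) q
  prod-periodic x k periodic zero    = refl
  prod-periodic x k periodic (suc q) = begin
    prod x (k ℕ.+ q ℕ.* k)
      ≡⟨ ≡.cong (prod x) (ℕP.+-comm k (q ℕ.* k)) ⟩
    prod x (q ℕ.* k ℕ.+ k)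
      ≈⟨ prod-+ x (q ℕ.* k) k ⟩
    prod (λ i → x (i ℕ.+ k)) (q ℕ.* k) * prod x k
      ≈⟨ *-congʳ (trans (prod-cong periodic (q ℕ.* k)) (prod-periodic x k periodic q)) ⟩
    pow (prod x k) q * prod x k
      ≈⟨ *-comm _ _ ⟩
    prod x k * pow (prod x k) q ∎

  prod-telescope : ∀ (a b c : ℕ → Carrier) → (∀ i → b i * c i ≈ c (suc i) * a i) →
    ∀ l → prod b l * c 0 ≈ c l * prod a l
  prod-telescope a b c step zero    = trans (*-identityˡ _) (sym (*-identityʳ _))
  prod-telescope a b c step (suc l) = begin
    (b l * prod b l) * c 0        ≈⟨ *-assoc _ _ _ ⟩
    b l * (prod b l * c 0)        ≈⟨ *-congˡ (prod-telescope a b c step l) ⟩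
    b l * (c l * prod a l)        ≈⟨ sym (*-assoc _ _ _) ⟩
    (b l * c l) * prod a l        ≈⟨ *-congʳ (step l) ⟩
    (c (suc l) * a l) * prod a l  ≈⟨ *-assoc _ _ _ ⟩
    c (suc l) * (a l * prod a l)  ∎

  iter-cong : ∀ {n} (F : PolyMap n) m {x y : Pt n} → x ≈ᵥ y → iter m (apply F) x ≈ᵥ iter m (apply F) y
  iter-cong F zero    x≈y = x≈y
  iter-cong F (suc m) x≈y = apply-cong F (iter-cong F m x≈y)

  iter-+ : ∀ {a} {A : Set a} (h : A → A) m k x → iter (m ℕ.+ k) h x ≡ iter m h (iter k h x)
  iter-+ h zero    k x = ≡.refl
  iter-+ h (suc m) k x = ≡.cong h (iter-+ h m k x)

  iter-periodic : ∀ {n} (F : PolyMap n) {x} k → iter k (apply F) x ≈ᵥ x →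
    ∀ m → iter (m ℕ.+ k) (apply F) x ≈ᵥ iter m (apply F) x
  iter-periodic F {x} k periodic m rewrite iter-+ (apply F) m k x = iter-cong F m periodic

  iter-repeat : ∀ {n} (F : PolyMap n) {x} k → iter k (apply F) x ≈ᵥ x → ∀ q → iter (q ℕ.* k) (apply F) x ≈ᵥ x
  iter-repeat F k periodic zero    i = refl
  iter-repeat F {x} k periodic (suc q) i rewrite ℕP.+-comm k (q ℕ.* k) =
    trans (iter-periodic F k periodic (q ℕ.* k) i) (iter-repeat F k periodic q i)

  period-divides : ∀ {n} (F : PolyMap n) {x} l l′ → IsPeriod F x l′ → iter l (apply F) x ≈ᵥ x →
    ∃ λ q → l ≡ q ℕ.* l′
  period-divides F l zero (() , _) _
  period-divides F {x} l l′@(suc _) (_ , periodic , minimal) l-periodic = l ℕD./ l′ , l≡q*l′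
    where
    r = l ℕD.% l′
    l≡r+q*l′ : l ≡ r ℕ.+ (l ℕD./ l′) ℕ.* l′
    l≡r+q*l′ = ℕD.m≡m%n+[m/n]*n l l′
    r-periodic : iter r (apply F) x ≈ᵥ x
    r-periodic i = begin
      iter r (apply F) x i
        ≈⟨ sym (iter-periodic F _ (iter-repeat F l′ periodic (l ℕD./ l′)) r i) ⟩
      iter (r ℕ.+ (l ℕD./ l′) ℕ.* l′) (apply F) x i
        ≡⟨ ≡.cong (λ m → iter m (apply F) x i) (≡.sym l≡r+q*l′) ⟩
      iter l (apply F) x i
        ≈⟨ l-periodic i ⟩
      x i ∎
    r≡0 : r ≡ 0
    r≡0 with r in r≡
    ... | zero   = ≡.refl
    ... | suc r′ = ⊥-elim (minimal (suc r′) (ℕ.s≤s ℕ.z≤n) (≡.subst (ℕ._< l′) r≡ (ℕD.m%n<n l l′))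
                                   (≡.subst (λ m → iter m (apply F) x ≈ᵥ x) r≡ r-periodic))
    l≡q*l′ : l ≡ (l ℕD./ l′) ℕ.* l′
    l≡q*l′ = ≡.trans l≡r+q*l′ (≡.cong (ℕ._+ (l ℕD./ l′) ℕ.* l′) r≡0)

  prodDet≈prod : ∀ {n} (F : PolyMap n) x l → prodDet F x l ≈ prod (λ i → det (jacobian F (iter (suc i) (apply F) x))) l
  prodDet≈prod F x zero    = refl
  prodDet≈prod F x (suc l) = *-congˡ (prodDet≈prod F x l)

  prodDet-repeat : ∀ {n} (F : PolyMap n) {x} k → iter k (apply F) x ≈ᵥ x → ∀ q →
    prodDet F x (q ℕ.* k) ≈ pow (prodDet F x k) q
  prodDet-repeat F {x} k periodic q = begin
    prodDet F x (q ℕ.* k)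
      ≈⟨ prodDet≈prod F x (q ℕ.* k) ⟩
    prod J (q ℕ.* k)
      ≈⟨ prod-periodic J k (λ i → det-cong (jacobian-cong F (iter-periodic F k periodic (suc i)))) q ⟩
    pow (prod J k) q
      ≈⟨ pow-cong (sym (prodDet≈prod F x k)) q ⟩
    pow (prodDet F x k) q ∎
    where
    J = λ i → det (jacobian F (iter (suc i) (apply F) x))

  -- Commuting polynomial maps.

  module Commuting {n} (f g : PolyMap n) (commute : ∀ x → apply f (apply g x) ≈ᵥ apply g (apply f x)) where
    df dg : Pt n → Carrier
    df y = det (jacobian f y)
    dg y = det (jacobian g y)

    -- Chain rule for f ∘ g = g ∘ f, then multiplicativity of det:
    -- det f′(g x) · det g′(x) ≈ det g′(f x) · det f′(x).
    jacobian-relation : ∀ x → df (apply g x) * dg x ≈ dg (apply f x) * df x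
    jacobian-relation x = begin
      df (apply g x) * dg x
        ≈⟨ sym (det-⊙ (jacobian f (apply g x)) (jacobian g x)) ⟩
      det (jacobian f (apply g x) ⊙ jacobian g x)
        ≈⟨ det-cong (sym ∘₂ jacobian-compose f g x) ⟩
      det (jacobian (compose f g) x)
        ≈⟨ det-cong (λ a b → ∂-unique (compose f g a) (compose g f a) (same-map a) b x) ⟩
      det (jacobian (compose g f) x)
        ≈⟨ det-cong (jacobian-compose g f x) ⟩
      det (jacobian g (apply f x) ⊙ jacobian f x)
        ≈⟨ det-⊙ (jacobian g (apply f x)) (jacobian f x) ⟩
      dg (apply f x) * df x ∎
      where
      same-map : ∀ a y → eval (compose f g a) y ≈ eval (compose g f a) y
      same-map a y = trans (eval-substitute (f a) g y) (trans (commute y a) (sym (eval-substitute (g a) f y)))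

    iter-commute : ∀ m x → apply g (iter m (apply f) x) ≈ᵥ iter m (apply f) (apply g x)
    iter-commute zero    x = λ i → refl
    iter-commute (suc m) x i = trans (sym (commute (iter m (apply f) x) i)) (apply-cong f (iter-commute m x) i)

    image-periodic : ∀ P l → iter l (apply f) P ≈ᵥ P → iter l (apply f) (apply g P) ≈ᵥ apply g P
    image-periodic P l periodic i = trans (sym (iter-commute l P i)) (apply-cong g periodic i)

    -- If f^l(P) ≈ P and P is not critical for g, the products of det f′ over l steps of the
    -- orbits of P and g(P) agree: they are conjugate by the nonzero factor det g′(P).
    prodDet-transport : ∀ P l → iter l (apply f) P ≈ᵥ P → ¬ (dg P ≈ 0#) → prodDet f P l ≈ prodDet f (apply g P) l
    prodDet-transport P l periodic dgP≉0 = begin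
      prodDet f P l            ≈⟨ prodDet≈prod f P l ⟩
      prod (a ∘ suc) l         ≈⟨ prod-rotate a l (df-cong periodic) ⟩
      prod a l                 ≈⟨ cancelˡ dgP≉0 (sym conjugate) ⟩
      prod b l                 ≈⟨ sym (prod-rotate b l (df-cong (image-periodic P l periodic))) ⟩
      prod (b ∘ suc) l         ≈⟨ sym (prodDet≈prod f (apply g P) l) ⟩
      prodDet f (apply g P) l  ∎
      where
      df-cong : ∀ {x y} → x ≈ᵥ y → df x ≈ df y
      df-cong x≈y = det-cong (jacobian-cong f x≈y)
      a b c′ : ℕ → Carrier
      a i  = df (iter i (apply f) P)
      b i  = df (iter i (apply f) (apply g P))
      c′ i = dg (iter i (apply f) P)
      step : ∀ i → b i * c′ i ≈ c′ (suc i) * a i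
      step i = trans (*-congʳ (df-cong (λ k → sym (iter-commute i P k)))) (jacobian-relation (iter i (apply f) P))
      conjugate : dg P * prod b l ≈ dg P * prod a l
      conjugate = begin
        dg P * prod b l   ≈⟨ *-comm _ _ ⟩
        prod b l * c′ 0   ≈⟨ prod-telescope a b c′ step l ⟩
        c′ l * prod a l   ≈⟨ *-congʳ (det-cong (jacobian-cong g periodic)) ⟩
        dg P * prod a l   ∎

proposition2p11 : ∀ {c ℓ} (K : AlgClosedChar0Field c ℓ) (n : ℕ)
    (f g : Poly.PolyMap K n) →
    (∀ x → Poly._≈ᵥ_ K (Poly.apply K f (Poly.apply K g x)) (Poly.apply K g (Poly.apply K f x))) →
    (P : Poly.Pt K n) (l l′ : ℕ) →
    Poly.IsPeriod K f P l →
    Poly.IsPeriod K f (Poly.apply K g P) l′ →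
    ¬ (AlgClosedChar0Field._≈_ K (Poly.det K (Poly.jacobian K g P)) (AlgClosedChar0Field.0# K)) →
    ∃ λ l₀ → (l ≡ l₀ ℕ.* l′)
      × AlgClosedChar0Field._≈_ K (Poly.multiplier K f P l)
          (AlgClosedChar0Field.pow K (Poly.multiplier K f (Poly.apply K g P) l′) l₀)
proposition2p11 K n f g commute P l l′ (_ , P-periodic , _) gP-period dgP≉0 = l₀ , l≡l₀*l′ , multiplier-power
  where
  open AlgClosedChar0Field K
  open Poly K
  open Proof K
  open Commuting f g commute
  open SetoidReasoning (CommutativeRing.setoid ring)
  -- the f-period of g(P) divides l, since g maps the orbit of P onto that of g(P)
  divides : ∃ λ q → l ≡ q ℕ.* l′
  divides = period-divides f l l′ gP-period (image-periodic P l P-periodic)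
  l₀ : ℕ
  l₀ = proj₁ divides
  l≡l₀*l′ : l ≡ l₀ ℕ.* l′
  l≡l₀*l′ = proj₂ divides
  multiplier-power : multiplier f P l ≈ pow (multiplier f (apply g P) l′) l₀
  multiplier-power = begin
    prodDet f P l                        ≈⟨ prodDet-transport P l P-periodic dgP≉0 ⟩
    prodDet f (apply g P) l              ≡⟨ ≡.cong (prodDet f (apply g P)) l≡l₀*l′ ⟩
    prodDet f (apply g P) (l₀ ℕ.* l′)    ≈⟨ prodDet-repeat f l′ (proj₁ (proj₂ gP-period)) l₀ ⟩
    pow (prodDet f (apply g P) l′) l₀    ∎
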